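{- Let $k>1$, $n$ and $h$ be positive integers with $n \geq kh-1$. Then the number of fractions $\alpha\in F_n$ with numerator equal to $h$ and $1/k<\alpha\leq 1/(k-1)$ is $\varphi(h)$. Furthermore, if in addition $h>2$, the number of fractions $\alpha \in F_n$ with numerator equal to $h$ and $1/k<\alpha<2/(2k-1)$ is $\varphi(h)/2$.
   Context: For a positive integer $n$, the Farey sequence $F_n$ of order $n$ is the ascending sequence of all irreducible fractions $a/b$ with $0<a/b\leq 1$ and $1\leq b\leq n$ (the fraction $0/1$ is excluded; $1/1$ is included). The numerator of a Farey fraction is that of its reduced form. $\varphi$ denotes Euler's totient function. -}

module Defs where

open import Data.Nat as ℕ using (ℕ; zero; suc; _≟_)
open import Data.Nat.GCD using (gcd)
open import Data.Integer as ℤ using (ℤ; +_)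
open import Data.Rational as ℚ using (ℚ; _/_)
open import Data.List using (List; []; _∷_; map; filter; concatMap; upTo; length)

range1 : ℕ → List ℕ
range1 n = map suc (upTo n)

φ : ℕ → ℕ
φ h = length (filter (λ a → gcd a h ≟ 1) (range1 h))

-- the rational p / d (only used with d ≥ 1; junk value 0 for d = 0)
frac : ℤ → ℕ → ℚ
frac p zero    = ℚ.0ℚ
frac p (suc d) = p / suc d

-- Farey sequence F_n as a list of rationals: all a/b with 1 ≤ a ≤ b ≤ n,
-- gcd a b = 1 (so 0/1 excluded, 1/1 included, each fraction once).
-- (Order is irrelevant for the counting statements.)
farey : ℕ → List ℚ
farey n = concatMap (λ b → map (λ a → frac (+ a) b)
                                (filter (λ a → gcd a b ≟ 1) (range1 b)))
                    (range1 n)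

module Submission where

-- A fraction of F_n with numerator h is h/b with h ≤ b ≤ n and gcd(h, b) = 1, and
-- 1/k < h/b ≤ 1/(k-1) says exactly (k-1)h ≤ b < kh.  Writing b = (k-1)h + c with 0 ≤ c < h,
-- gcd(h, b) = gcd(c, h), and n ≥ kh - 1 puts all these b in range, so the count is the number
-- of residues c < h coprime to h, i.e. φ(h).  The bound h/b < 2/(2k-1) adds the condition
-- 2c > h; since c ↦ h - c exchanges the coprime residues below and above h/2 (and h/2 itself
-- is not coprime to h when h > 2), exactly half of them satisfy it.

open import Defs
open import Data.Nat as ℕ using (ℕ; zero; suc; _+_; _*_; _∸_; _≤_; _<_; _≥_; _>_; _/_; _≟_; NonZero; ≢-nonZero⁻¹; >-nonZero⁻¹; s≤s; z<s; s<s)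
open import Data.Nat.Properties hiding (_≤?_; _<?_)
open import Algebra.Properties.CommutativeSemigroup +-commutativeSemigroup using (interchange)
open import Algebra.Properties.CommutativeSemigroup *-commutativeSemigroup using ()
  renaming (x∙yz≈y∙xz to x*[y*z]≡y*[x*z])
open import Data.Nat.DivMod using (m*n/n≡m)
open import Data.Nat.GCD using (gcd; gcd-GCD; gcd-comm; gcd-identityˡ; gcd-identityʳ; module GCD)
open import Data.Nat.Coprimality using (gcd≡1⇒coprime)
import Data.Integer as ℤ
import Data.Integer.Properties as ℤP
open import Data.Rational as ℚ using (ℚ)
import Data.Rational.Properties as ℚP
import Data.Rational.Unnormalised as ℚᵘ
import Data.Rational.Unnormalised.Properties as ℚᵘP
open import Data.Bool using (true; false; if_then_else_)
open import Data.List using (List; []; _∷_; map; filter; concatMap; applyUpTo; length; _++_)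
open import Data.Product using (_×_; _,_; proj₁; proj₂)
open import Data.Product.Function.NonDependent.Propositional using (_×-⇔_)
open import Function using (_∘_; _⇔_; mk⇔; Equivalence)
open import Level using (Level)
open import Relation.Nullary using (Dec; yes; no; does; ¬_; ¬?; contradiction)
open import Relation.Nullary.Decidable using (_×-dec_)
open import Relation.Binary.PropositionalEquality

private
  variable
    ℓ ℓ′ : Level
    A B : Set ℓ
    f g : ℕ → ℕ
    m n : ℕ

open ≡-Reasoning
open Equivalence using (to; from)

-- Indicators and finite sums

𝟙 : Dec A → ℕ
𝟙 d = if does d then 1 else 0

𝟙-yes : (d : Dec A) → A → 𝟙 d ≡ 1
𝟙-yes (yes _) _ = refl
𝟙-yes (no ¬x) x = contradiction x ¬x

𝟙-no : (d : Dec A) → ¬ A → 𝟙 d ≡ 0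
𝟙-no (yes x) ¬x = contradiction x ¬x
𝟙-no (no _) _ = refl

𝟙-×-dec : (d : Dec A) (e : Dec B) → 𝟙 (d ×-dec e) ≡ 𝟙 d * 𝟙 e
𝟙-×-dec (yes _) (yes _) = refl
𝟙-×-dec (yes _) (no _) = refl
𝟙-×-dec (no _) _ = refl

𝟙-⇔ : A ⇔ B → (d : Dec A) (e : Dec B) → 𝟙 d ≡ 𝟙 e
𝟙-⇔ A⇔B (yes x) e = sym (𝟙-yes e (to A⇔B x))
𝟙-⇔ A⇔B (no ¬x) e = sym (𝟙-no e (¬x ∘ from A⇔B))

𝟙+𝟙¬≡1 : (d : Dec A) → 𝟙 d + 𝟙 (¬? d) ≡ 1
𝟙+𝟙¬≡1 (yes _) = refl
𝟙+𝟙¬≡1 (no _) = refl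

𝟙-*-cong : ∀ {x y} (d : Dec A) → (A → x ≡ y) → 𝟙 d * x ≡ 𝟙 d * y
𝟙-*-cong (yes x) eq = cong (1 *_) (eq x)
𝟙-*-cong (no _)  eq = refl

∑ₗ : (A → ℕ) → List A → ℕ
∑ₗ w [] = 0
∑ₗ w (x ∷ xs) = w x + ∑ₗ w xs

length-filter≡∑ₗ𝟙 : ∀ {P : A → Set ℓ′} (P? : ∀ x → Dec (P x)) xs →
                    length (filter P? xs) ≡ ∑ₗ (𝟙 ∘ P?) xs
length-filter≡∑ₗ𝟙 P? [] = refl
length-filter≡∑ₗ𝟙 P? (x ∷ xs) with does (P? x)
... | true  = cong suc (length-filter≡∑ₗ𝟙 P? xs)
... | false = length-filter≡∑ₗ𝟙 P? xs

∑ₗ-map : ∀ (w : B → ℕ) (h : A → B) xs → ∑ₗ w (map h xs) ≡ ∑ₗ (w ∘ h) xs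
∑ₗ-map w h [] = refl
∑ₗ-map w h (x ∷ xs) = cong (w (h x) +_) (∑ₗ-map w h xs)

∑ₗ-filter : ∀ {P : A → Set ℓ′} (P? : ∀ x → Dec (P x)) (w : A → ℕ) xs →
            ∑ₗ w (filter P? xs) ≡ ∑ₗ (λ x → 𝟙 (P? x) * w x) xs
∑ₗ-filter P? w [] = refl
∑ₗ-filter P? w (x ∷ xs) with does (P? x)
... | true  = cong₂ _+_ (sym (+-identityʳ (w x))) (∑ₗ-filter P? w xs)
... | false = ∑ₗ-filter P? w xs

∑ₗ-++ : ∀ (w : A → ℕ) xs ys → ∑ₗ w (xs ++ ys) ≡ ∑ₗ w xs + ∑ₗ w ys
∑ₗ-++ w [] ys = refl
∑ₗ-++ w (x ∷ xs) ys = trans (cong (w x +_) (∑ₗ-++ w xs ys)) (sym (+-assoc (w x) _ _))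

∑ₗ-concatMap : ∀ (w : B → ℕ) (h : A → List B) xs →
               ∑ₗ w (concatMap h xs) ≡ ∑ₗ (∑ₗ w ∘ h) xs
∑ₗ-concatMap w h [] = refl
∑ₗ-concatMap w h (x ∷ xs) =
  trans (∑ₗ-++ w (h x) _) (cong (∑ₗ w (h x) +_) (∑ₗ-concatMap w h xs))

∑< : ℕ → (ℕ → ℕ) → ℕ
∑< zero    f = 0
∑< (suc n) f = f 0 + ∑< n (f ∘ suc)

syntax ∑< n (λ i → e) = ∑[ i < n ] e

∑ₗ-applyUpTo : ∀ (w : A → ℕ) (h : ℕ → A) n → ∑ₗ w (applyUpTo h n) ≡ ∑< n (w ∘ h)
∑ₗ-applyUpTo w h zero = refl
∑ₗ-applyUpTo w h (suc n) = cong (w (h 0) +_) (∑ₗ-applyUpTo w (h ∘ suc) n)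

∑ₗ-range1 : ∀ (w : ℕ → ℕ) n → ∑ₗ w (range1 n) ≡ ∑[ i < n ] w (suc i)
∑ₗ-range1 w n = trans (∑ₗ-map w suc (applyUpTo (λ i → i) n)) (∑ₗ-applyUpTo (w ∘ suc) (λ i → i) n)

∑-cong : ∀ n → (∀ {i} → i < n → f i ≡ g i) → ∑< n f ≡ ∑< n g
∑-cong zero    eq = refl
∑-cong (suc n) eq = cong₂ _+_ (eq z<s) (∑-cong n (eq ∘ s<s))

∑-zero : ∀ n → (∀ {i} → i < n → f i ≡ 0) → ∑< n f ≡ 0
∑-zero zero    eq = refl
∑-zero (suc n) eq = cong₂ _+_ (eq z<s) (∑-zero n (eq ∘ s<s))

∑-+ : ∀ m n (f : ℕ → ℕ) → ∑< (m + n) f ≡ ∑< m f + ∑< n (f ∘ (m +_))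
∑-+ zero    n f = refl
∑-+ (suc m) n f = trans (cong (f 0 +_) (∑-+ m n (f ∘ suc))) (sym (+-assoc (f 0) _ _))

∑-distrib-+ : ∀ n → ∑[ i < n ] (f i + g i) ≡ ∑< n f + ∑< n g
∑-distrib-+ zero = refl
∑-distrib-+ {f} {g} (suc n) =
  trans (cong (f 0 + g 0 +_) (∑-distrib-+ n)) (interchange (f 0) (g 0) _ _)

∑-last : ∀ n (f : ℕ → ℕ) → ∑< (suc n) f ≡ ∑< n f + f n
∑-last zero    f = +-identityʳ (f 0)
∑-last (suc n) f = trans (cong (f 0 +_) (∑-last n (f ∘ suc))) (sym (+-assoc (f 0) _ _))

∑-reverse : ∀ n (f : ℕ → ℕ) → ∑< n f ≡ ∑[ i < n ] f (n ∸ suc i)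
∑-reverse zero    f = refl
∑-reverse (suc n) f = begin
  ∑< (suc n) f                         ≡⟨ ∑-last n f ⟩
  ∑< n f + f n                         ≡⟨ cong (_+ f n) (∑-reverse n f) ⟩
  ∑[ i < n ] f (n ∸ suc i) + f n       ≡⟨ +-comm _ (f n) ⟩
  f n + ∑[ i < n ] f (n ∸ suc i)       ∎

∑-rotate : ∀ n (f : ℕ → ℕ) → f 0 ≡ f n → ∑[ i < n ] f (suc i) ≡ ∑< n f
∑-rotate n f f0≡fn = +-cancelˡ-≡ (f 0) _ _ (begin
  ∑< (suc n) f   ≡⟨ ∑-last n f ⟩
  ∑< n f + f n   ≡⟨ cong (∑< n f +_) (sym f0≡fn) ⟩
  ∑< n f + f 0   ≡⟨ +-comm _ (f 0) ⟩
  f 0 + ∑< n f   ∎)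

∑-reflect : ∀ n (f : ℕ → ℕ) → f 0 ≡ f n → ∑[ i < n ] f (n ∸ i) ≡ ∑< n f
∑-reflect n f f0≡fn = begin
  ∑[ i < n ] f (n ∸ i)               ≡⟨ ∑-reverse n _ ⟩
  ∑[ i < n ] f (n ∸ (n ∸ suc i))     ≡⟨ ∑-cong n (λ i<n → cong f (m∸[m∸n]≡n i<n)) ⟩
  ∑[ i < n ] f (suc i)               ≡⟨ ∑-rotate n f f0≡fn ⟩
  ∑< n f                             ∎

∑-window : ∀ m l n (f : ℕ → ℕ) → m + l ≤ n →
           (∀ {i} → i < m → f i ≡ 0) → (∀ {i} → m + l ≤ i → f i ≡ 0) →
           ∑< n f ≡ ∑[ i < l ] f (m + i)
∑-window m l n f m+l≤n below above = begin
  ∑< n f                                         ≡⟨ cong (λ n → ∑< n f) (sym (m+[n∸m]≡n m+l≤n)) ⟩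
  ∑< (m + l + r) f                               ≡⟨ ∑-+ (m + l) r f ⟩
  ∑< (m + l) f + ∑[ i < r ] f (m + l + i)        ≡⟨ cong₂ _+_ (∑-+ m l f) (∑-zero r (λ {i} _ → above (m≤m+n (m + l) i))) ⟩
  ∑< m f + ∑[ i < l ] f (m + i) + 0              ≡⟨ +-identityʳ _ ⟩
  ∑< m f + ∑[ i < l ] f (m + i)                  ≡⟨ cong (_+ ∑[ i < l ] f (m + i)) (∑-zero m below) ⟩
  ∑[ i < l ] f (m + i)                           ∎
  where
  r : ℕ
  r = n ∸ (m + l)

∑-δ : ∀ n h (f : ℕ → ℕ) → ∑[ i < n ] (𝟙 (i ≟ h) * f i) ≡ 𝟙 (h ℕ.<? n) * f h
∑-δ zero    h       f = refl
∑-δ (suc n) zero    f = trans (cong (1 * f 0 +_) (∑-zero n (λ _ → refl))) (+-identityʳ _)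
-- suc i ≟ suc h and suc h <? suc n compute to i ≟ h and h <? n
∑-δ (suc n) (suc h) f = ∑-δ n h (f ∘ suc)

-- Greatest common divisors and the totient

gcd[m,m+n]≡gcd[m,n] : ∀ m n → gcd m (m + n) ≡ gcd m n
gcd[m,m+n]≡gcd[m,n] m n = GCD.unique (gcd-GCD m (m + n)) (GCD.step (gcd-GCD m n))

gcd[m,m*n+o]≡gcd[m,o] : ∀ m n o → gcd m (m * n + o) ≡ gcd m o
gcd[m,m*n+o]≡gcd[m,o] m zero    o = cong (λ x → gcd m (x + o)) (*-zeroʳ m)
gcd[m,m*n+o]≡gcd[m,o] m (suc n) o = begin
  gcd m (m * suc n + o)     ≡⟨ cong (λ x → gcd m (x + o)) (*-suc m n) ⟩
  gcd m (m + m * n + o)     ≡⟨ cong (gcd m) (+-assoc m (m * n) o) ⟩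
  gcd m (m + (m * n + o))   ≡⟨ gcd[m,m+n]≡gcd[m,n] m (m * n + o) ⟩
  gcd m (m * n + o)         ≡⟨ gcd[m,m*n+o]≡gcd[m,o] m n o ⟩
  gcd m o                   ∎

gcd[n,n]≡n : ∀ n → gcd n n ≡ n
gcd[n,n]≡n n = GCD.unique (gcd-GCD n n) GCD.refl

gcd[n,2n]≡n : ∀ n → gcd n (2 * n) ≡ n
gcd[n,2n]≡n n = begin
  gcd n (n + (n + 0))   ≡⟨ gcd[m,m+n]≡gcd[m,n] n (n + 0) ⟩
  gcd n (n + 0)         ≡⟨ gcd[m,m+n]≡gcd[m,n] n 0 ⟩
  gcd n 0               ≡⟨ gcd-identityʳ n ⟩
  n                     ∎

gcd[m∸n,m]≡gcd[n,m] : n ≤ m → gcd (m ∸ n) m ≡ gcd n m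
gcd[m∸n,m]≡gcd[n,m] {n} {m} n≤m = begin
  gcd (m ∸ n) m               ≡⟨ cong (gcd (m ∸ n)) (m∸n+n≡m n≤m) ⟨
  gcd (m ∸ n) (m ∸ n + n)     ≡⟨ gcd[m,m+n]≡gcd[m,n] (m ∸ n) n ⟩
  gcd (m ∸ n) n               ≡⟨ gcd-comm (m ∸ n) n ⟩
  gcd n (m ∸ n)               ≡⟨ gcd[m,m+n]≡gcd[m,n] n (m ∸ n) ⟨
  gcd n (n + (m ∸ n))         ≡⟨ cong (gcd n) (m+[n∸m]≡n n≤m) ⟩
  gcd n m                     ∎

φ≡∑coprime : ∀ h → φ h ≡ ∑[ c < h ] 𝟙 (gcd c h ≟ 1)
φ≡∑coprime h = begin
  φ h                                      ≡⟨ length-filter≡∑ₗ𝟙 (λ c → gcd c h ≟ 1) (range1 h) ⟩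
  ∑ₗ (λ c → 𝟙 (gcd c h ≟ 1)) (range1 h)   ≡⟨ ∑ₗ-range1 (λ c → 𝟙 (gcd c h ≟ 1)) h ⟩
  ∑[ c < h ] 𝟙 (gcd (suc c) h ≟ 1)         ≡⟨ ∑-rotate h (λ c → 𝟙 (gcd c h ≟ 1)) (cong (λ g → 𝟙 (g ≟ 1)) gcd[0,h]≡gcd[h,h]) ⟩
  ∑[ c < h ] 𝟙 (gcd c h ≟ 1)               ∎
  where
  gcd[0,h]≡gcd[h,h] : gcd 0 h ≡ gcd h h
  gcd[0,h]≡gcd[h,h] = trans (gcd-identityˡ h) (sym (gcd[n,n]≡n h))

m+n<2n⇔m<n : ∀ m n → m + n < 2 * n ⇔ m < n
m+n<2n⇔m<n m n = mk⇔ (+-cancelʳ-< n m n ∘ subst (m + n <_) 2n≡n+n)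
                     (subst (m + n <_) (sym 2n≡n+n) ∘ +-monoˡ-< n)
  where
  2n≡n+n : 2 * n ≡ n + n
  2n≡n+n = cong (n +_) (+-identityʳ n)

-- With h = c + t, both sides say t < c (the case t = c being excluded).
¬h<2t⇔h<2c : ∀ {c t h} → c + t ≡ h → h ≢ 2 * c → (¬ h < 2 * t) ⇔ h < 2 * c
¬h<2t⇔h<2c {c} {t} refl h≢2c = mk⇔
  (λ ¬c+t<2t → subst (_< 2 * c) (+-comm t c)
     (from (m+n<2n⇔m<n t c) (≤∧≢⇒< (≮⇒≥ (¬c+t<2t ∘ from (m+n<2n⇔m<n c t))) t≢c)))
  (λ c+t<2c c+t<2t → <-asym (to (m+n<2n⇔m<n c t) c+t<2t)
     (to (m+n<2n⇔m<n t c) (subst (_< 2 * c) (+-comm c t) c+t<2c)))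
  where
  t≢c : t ≢ c
  t≢c t≡c = h≢2c (cong (c +_) (trans t≡c (sym (+-identityʳ c))))

gcd[c,h]≡1⇒h≢2c : ∀ {c h} → 2 < h → gcd c h ≡ 1 → h ≢ 2 * c
gcd[c,h]≡1⇒h≢2c {c} 2<h gcd[c,h]≡1 h≡2c = <⇒≢ 2<h (sym (trans h≡2c (cong (2 *_) c≡1)))
  where
  c≡1 : c ≡ 1
  c≡1 = trans (sym (gcd[n,2n]≡n c)) (trans (cong (gcd c) (sym h≡2c)) gcd[c,h]≡1)

φ/2≡∑coprime>h/2 : ∀ h → 2 < h → φ h / 2 ≡ ∑[ c < h ] (𝟙 (gcd c h ≟ 1) * 𝟙 (h ℕ.<? 2 * c))
φ/2≡∑coprime>h/2 h 2<h = begin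
  φ h / 2              ≡⟨ cong (_/ 2) (φ≡∑coprime h) ⟩
  ∑< h coprime / 2     ≡⟨ cong (_/ 2) ∑coprime≡U*2 ⟩
  U * 2 / 2            ≡⟨ m*n/n≡m U 2 ⟩
  U                    ∎
  where
  coprime upper lower : ℕ → ℕ
  coprime c = 𝟙 (gcd c h ≟ 1)
  upper c = coprime c * 𝟙 (h ℕ.<? 2 * c)
  lower c = coprime c * 𝟙 (¬? (h ℕ.<? 2 * c))

  U : ℕ
  U = ∑< h upper

  split : ∀ c → coprime c ≡ upper c + lower c
  split c = begin
    coprime c                          ≡⟨ *-identityʳ (coprime c) ⟨
    coprime c * 1                      ≡⟨ cong (coprime c *_) (𝟙+𝟙¬≡1 (h ℕ.<? 2 * c)) ⟨
    coprime c * (𝟙 (h ℕ.<? 2 * c) + 𝟙 (¬? (h ℕ.<? 2 * c)))  ≡⟨ *-distribˡ-+ (coprime c) _ _ ⟩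
    upper c + lower c                  ∎

  lower0≡lowerh : lower 0 ≡ lower h
  lower0≡lowerh = begin
    lower 0                                   ≡⟨ cong (_* 𝟙 (¬? (h ℕ.<? 0))) (𝟙-no (gcd 0 h ≟ 1) gcd[0,h]≢1) ⟩
    0                                         ≡⟨ *-zeroʳ (coprime h) ⟨
    coprime h * 0                             ≡⟨ cong (coprime h *_) (𝟙-no (¬? (h ℕ.<? 2 * h)) (λ ¬h<2h → ¬h<2h h<2h)) ⟨
    lower h                                   ∎
    where
    gcd[0,h]≢1 : gcd 0 h ≢ 1
    gcd[0,h]≢1 eq = <⇒≢ (<-trans (n<1+n 1) 2<h) (sym (trans (sym (gcd-identityˡ h)) eq))
    h<2h : h < 2 * h
    h<2h = m<m+n h (subst (0 <_) (sym (+-identityʳ h)) (<-trans z<s 2<h))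

  lower[h∸c]≡upper[c] : ∀ {c} → c < h → lower (h ∸ c) ≡ upper c
  lower[h∸c]≡upper[c] {c} c<h = begin
    coprime (h ∸ c) * 𝟙 (¬? (h ℕ.<? 2 * (h ∸ c)))
      ≡⟨ cong (λ g → 𝟙 (g ≟ 1) * 𝟙 (¬? (h ℕ.<? 2 * (h ∸ c)))) (gcd[m∸n,m]≡gcd[n,m] (<⇒≤ c<h)) ⟩
    coprime c * 𝟙 (¬? (h ℕ.<? 2 * (h ∸ c)))
      ≡⟨ 𝟙-*-cong (gcd c h ≟ 1) (λ cop →
           𝟙-⇔ (¬h<2t⇔h<2c {c} (m+[n∸m]≡n (<⇒≤ c<h)) (gcd[c,h]≡1⇒h≢2c {c} 2<h cop))
               (¬? (h ℕ.<? 2 * (h ∸ c))) (h ℕ.<? 2 * c)) ⟩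
    upper c
      ∎

  ∑coprime≡U*2 : ∑< h coprime ≡ U * 2
  ∑coprime≡U*2 = begin
    ∑< h coprime                        ≡⟨ ∑-cong h (λ {c} _ → split c) ⟩
    ∑[ c < h ] (upper c + lower c)      ≡⟨ ∑-distrib-+ h ⟩
    U + ∑< h lower                      ≡⟨ cong (U +_) (∑-reflect h lower lower0≡lowerh) ⟨
    U + ∑[ c < h ] lower (h ∸ c)        ≡⟨ cong (U +_) (∑-cong h lower[h∸c]≡upper[c]) ⟩
    U + U                               ≡⟨ cong (U +_) (*-identityʳ U) ⟨
    U + U * 1                           ≡⟨ *-suc U 1 ⟨
    U * 2                               ∎

-- Comparing fractions

fromℚᵘ-<⇔ : ∀ u v → ℚ.fromℚᵘ u ℚ.< ℚ.fromℚᵘ v ⇔ u ℚᵘ.< v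
fromℚᵘ-<⇔ u v = mk⇔
  (λ lt → ℚᵘP.<-respʳ-≃ (ℚP.toℚᵘ-fromℚᵘ v) (ℚᵘP.<-respˡ-≃ (ℚP.toℚᵘ-fromℚᵘ u) (ℚP.toℚᵘ-mono-< lt)))
  (λ lt → ℚP.toℚᵘ-cancel-< (ℚᵘP.<-respʳ-≃ (ℚᵘP.≃-sym (ℚP.toℚᵘ-fromℚᵘ v))
                            (ℚᵘP.<-respˡ-≃ (ℚᵘP.≃-sym (ℚP.toℚᵘ-fromℚᵘ u)) lt)))

fromℚᵘ-≤⇔ : ∀ u v → ℚ.fromℚᵘ u ℚ.≤ ℚ.fromℚᵘ v ⇔ u ℚᵘ.≤ v
fromℚᵘ-≤⇔ u v = mk⇔
  (λ le → ℚᵘP.≤-respʳ-≃ (ℚP.toℚᵘ-fromℚᵘ v) (ℚᵘP.≤-respˡ-≃ (ℚP.toℚᵘ-fromℚᵘ u) (ℚP.toℚᵘ-mono-≤ le)))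
  (λ le → ℚP.toℚᵘ-cancel-≤ (ℚᵘP.≤-respʳ-≃ (ℚᵘP.≃-sym (ℚP.toℚᵘ-fromℚᵘ v))
                            (ℚᵘP.≤-respˡ-≃ (ℚᵘP.≃-sym (ℚP.toℚᵘ-fromℚᵘ u)) le)))

-- No coprimality is needed: frac (+ x) (suc m) is fromℚᵘ (mkℚᵘ (+ x) m) by definition.
frac<frac⇔ : ∀ x m y n → frac (ℤ.+ x) (suc m) ℚ.< frac (ℤ.+ y) (suc n) ⇔ x * suc n < y * suc m
frac<frac⇔ x m y n = mk⇔
  (ℤP.drop‿+<+ ∘ subst₂ ℤ._<_ (sym (ℤP.pos-* x (suc n))) (sym (ℤP.pos-* y (suc m)))
    ∘ ℚᵘP.drop-*<* ∘ to (fromℚᵘ-<⇔ (ℚᵘ.mkℚᵘ (ℤ.+ x) m) (ℚᵘ.mkℚᵘ (ℤ.+ y) n)))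
  (from (fromℚᵘ-<⇔ (ℚᵘ.mkℚᵘ (ℤ.+ x) m) (ℚᵘ.mkℚᵘ (ℤ.+ y) n))
    ∘ ℚᵘ.*<* ∘ subst₂ ℤ._<_ (ℤP.pos-* x (suc n)) (ℤP.pos-* y (suc m)) ∘ ℤ.+<+)

frac≤frac⇔ : ∀ x m y n → frac (ℤ.+ x) (suc m) ℚ.≤ frac (ℤ.+ y) (suc n) ⇔ x * suc n ≤ y * suc m
frac≤frac⇔ x m y n = mk⇔
  (ℤP.drop‿+≤+ ∘ subst₂ ℤ._≤_ (sym (ℤP.pos-* x (suc n))) (sym (ℤP.pos-* y (suc m)))
    ∘ ℚᵘP.drop-*≤* ∘ to (fromℚᵘ-≤⇔ (ℚᵘ.mkℚᵘ (ℤ.+ x) m) (ℚᵘ.mkℚᵘ (ℤ.+ y) n)))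
  (from (fromℚᵘ-≤⇔ (ℚᵘ.mkℚᵘ (ℤ.+ x) m) (ℚᵘ.mkℚᵘ (ℤ.+ y) n))
    ∘ ℚᵘ.*≤* ∘ subst₂ ℤ._≤_ (ℤP.pos-* x (suc n)) (ℤP.pos-* y (suc m)) ∘ ℤ.+≤+)

↥-frac : ∀ {a d} → gcd a (suc d) ≡ 1 → ℚ.↥ (frac (ℤ.+ a) (suc d)) ≡ ℤ.+ a
↥-frac gcd≡1 = cong ℚ.↥_ (ℚP.normalize-coprime (gcd≡1⇒coprime gcd≡1))

-- Counting Farey fractions with a given numerator

farey-row : ℕ → List ℚ
farey-row b = map (λ a → frac (ℤ.+ a) b) (filter (λ a → gcd a b ≟ 1) (range1 b))

module _ {Q : ℚ → Set ℓ} (Q? : ∀ α → Dec (Q α)) (h : ℕ) .{{_ : NonZero h}} where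

  withNumerator? : ∀ α → Dec (ℚ.↥ α ≡ ℤ.+ h × Q α)
  withNumerator? α = (ℚ.↥ α ℤP.≟ ℤ.+ h) ×-dec Q? α

  𝟙-withNumerator : ∀ {a d} → gcd a (suc d) ≡ 1 →
                    𝟙 (withNumerator? (frac (ℤ.+ a) (suc d))) ≡ 𝟙 (a ≟ h) * 𝟙 (Q? (frac (ℤ.+ a) (suc d)))
  𝟙-withNumerator {a} {d} gcd≡1 = begin
    𝟙 (withNumerator? α)                  ≡⟨ 𝟙-×-dec (ℚ.↥ α ℤP.≟ ℤ.+ h) (Q? α) ⟩
    𝟙 (ℚ.↥ α ℤP.≟ ℤ.+ h) * 𝟙 (Q? α)       ≡⟨ cong (_* 𝟙 (Q? α)) (𝟙-⇔ ↥α≡h⇔a≡h (ℚ.↥ α ℤP.≟ ℤ.+ h) (a ≟ h)) ⟩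
    𝟙 (a ≟ h) * 𝟙 (Q? α)                  ∎
    where
    α : ℚ
    α = frac (ℤ.+ a) (suc d)
    ↥α≡h⇔a≡h : ℚ.↥ α ≡ ℤ.+ h ⇔ a ≡ h
    ↥α≡h⇔a≡h = mk⇔ (ℤP.+-injective ∘ trans (sym (↥-frac gcd≡1))) (λ a≡h → trans (↥-frac gcd≡1) (cong (λ x → ℤ.+ x) a≡h))

  module _ {N : ℕ → Set ℓ′} (N? : ∀ b → Dec (N b)) (Q⇔N : ∀ d → Q (frac (ℤ.+ h) (suc d)) ⇔ N (suc d)) where

    count-row : ∀ d → ∑ₗ (𝟙 ∘ withNumerator?) (farey-row (suc d))
                      ≡ 𝟙 (h ℕ.≤? suc d) * (𝟙 (gcd h (suc d) ≟ 1) * 𝟙 (N? (suc d)))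
    count-row d = begin
      ∑ₗ (𝟙 ∘ withNumerator?) (farey-row b)
        ≡⟨ ∑ₗ-map (𝟙 ∘ withNumerator?) (λ a → frac (ℤ.+ a) b) (filter (λ a → gcd a b ≟ 1) (range1 b)) ⟩
      ∑ₗ (λ a → 𝟙 (withNumerator? (frac (ℤ.+ a) b))) (filter (λ a → gcd a b ≟ 1) (range1 b))
        ≡⟨ ∑ₗ-filter (λ a → gcd a b ≟ 1) _ (range1 b) ⟩
      ∑ₗ (λ a → 𝟙 (gcd a b ≟ 1) * 𝟙 (withNumerator? (frac (ℤ.+ a) b))) (range1 b)
        ≡⟨ ∑ₗ-range1 _ b ⟩
      ∑[ i < b ] (𝟙 (gcd (suc i) b ≟ 1) * 𝟙 (withNumerator? (frac (ℤ.+ suc i) b)))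
        ≡⟨ ∑-cong b (λ {i} _ → only-numerator-h (suc i)) ⟩
      ∑[ i < b ] (𝟙 (suc i ≟ h) * G (suc i))
        ≡⟨ cong (_+ ∑[ i < b ] (𝟙 (suc i ≟ h) * G (suc i))) (cong (_* G 0) (𝟙-no (0 ≟ h) (≢-nonZero⁻¹ h ∘ sym))) ⟨
      ∑[ a < suc b ] (𝟙 (a ≟ h) * G a)
        ≡⟨ ∑-δ (suc b) h G ⟩
      𝟙 (h ℕ.<? suc b) * G h
        ≡⟨ cong₂ _*_ (𝟙-⇔ (mk⇔ m<1+n⇒m≤n s≤s) (h ℕ.<? suc b) (h ℕ.≤? b))
                     (cong (𝟙 (gcd h b ≟ 1) *_) (𝟙-⇔ (Q⇔N d) (Q? (frac (ℤ.+ h) b)) (N? b))) ⟩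
      𝟙 (h ℕ.≤? b) * (𝟙 (gcd h b ≟ 1) * 𝟙 (N? b))
        ∎
      where
      b : ℕ
      b = suc d
      G : ℕ → ℕ
      G a = 𝟙 (gcd a b ≟ 1) * 𝟙 (Q? (frac (ℤ.+ a) b))
      only-numerator-h : ∀ a → 𝟙 (gcd a b ≟ 1) * 𝟙 (withNumerator? (frac (ℤ.+ a) b)) ≡ 𝟙 (a ≟ h) * G a
      only-numerator-h a = trans (𝟙-*-cong (gcd a b ≟ 1) (𝟙-withNumerator {a} {d}))
                                 (x*[y*z]≡y*[x*z] (𝟙 (gcd a b ≟ 1)) (𝟙 (a ≟ h)) _)

    count-withNumerator : ∀ n → length (filter withNumerator? (farey n))
                                ≡ ∑[ b < suc n ] (𝟙 (h ℕ.≤? b) * (𝟙 (gcd h b ≟ 1) * 𝟙 (N? b)))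
    count-withNumerator n = begin
      length (filter withNumerator? (farey n))
        ≡⟨ length-filter≡∑ₗ𝟙 withNumerator? (farey n) ⟩
      ∑ₗ (𝟙 ∘ withNumerator?) (concatMap farey-row (range1 n))
        ≡⟨ ∑ₗ-concatMap (𝟙 ∘ withNumerator?) farey-row (range1 n) ⟩
      ∑ₗ (∑ₗ (𝟙 ∘ withNumerator?) ∘ farey-row) (range1 n)
        ≡⟨ ∑ₗ-range1 _ n ⟩
      ∑[ d < n ] ∑ₗ (𝟙 ∘ withNumerator?) (farey-row (suc d))
        ≡⟨ ∑-cong n (λ {d} _ → count-row d) ⟩
      ∑[ d < n ] term (suc d)
        ≡⟨ cong (_+ ∑[ d < n ] term (suc d)) (cong (_* (𝟙 (gcd h 0 ≟ 1) * 𝟙 (N? 0))) (𝟙-no (h ℕ.≤? 0) (<⇒≱ (>-nonZero⁻¹ h)))) ⟨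
      ∑[ b < suc n ] term b
        ∎
      where
      term : ℕ → ℕ
      term b = 𝟙 (h ℕ.≤? b) * (𝟙 (gcd h b ≟ 1) * 𝟙 (N? b))

m*[1+n]≡m*n+m : ∀ m n → m * suc n ≡ m * n + m
m*[1+n]≡m*n+m m n = trans (*-suc m n) (+-comm m (m * n))

∑-coprime-window : ∀ {N : ℕ → Set ℓ} (N? : ∀ b → Dec (N b)) h k n .{{_ : NonZero k}} →
                   h * suc k ≤ suc n → (∀ {b} → N b → h * k ≤ b × b < h * suc k) →
                   ∑[ b < suc n ] (𝟙 (h ℕ.≤? b) * (𝟙 (gcd h b ≟ 1) * 𝟙 (N? b)))
                   ≡ ∑[ c < h ] (𝟙 (gcd c h ≟ 1) * 𝟙 (N? (h * k + c)))
∑-coprime-window {N = N} N? h k n hk≤1+n bounds = trans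
  (∑-window (h * k) h (suc n) term (subst (_≤ suc n) (m*[1+n]≡m*n+m h k) hk≤1+n) below above)
  (∑-cong h in-window)
  where
  term : ℕ → ℕ
  term b = 𝟙 (h ℕ.≤? b) * (𝟙 (gcd h b ≟ 1) * 𝟙 (N? b))

  vanish : ∀ {b} → ¬ N b → term b ≡ 0
  vanish {b} ¬N = begin
    𝟙 (h ℕ.≤? b) * (𝟙 (gcd h b ≟ 1) * 𝟙 (N? b))   ≡⟨ cong (λ x → 𝟙 (h ℕ.≤? b) * (𝟙 (gcd h b ≟ 1) * x)) (𝟙-no (N? b) ¬N) ⟩
    𝟙 (h ℕ.≤? b) * (𝟙 (gcd h b ≟ 1) * 0)           ≡⟨ cong (𝟙 (h ℕ.≤? b) *_) (*-zeroʳ (𝟙 (gcd h b ≟ 1))) ⟩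
    𝟙 (h ℕ.≤? b) * 0                               ≡⟨ *-zeroʳ (𝟙 (h ℕ.≤? b)) ⟩
    0                                              ∎

  below : ∀ {b} → b < h * k → term b ≡ 0
  below b<hk = vanish (λ Nb → <⇒≱ b<hk (proj₁ (bounds Nb)))

  above : ∀ {b} → h * k + h ≤ b → term b ≡ 0
  above {b} hk+h≤b = vanish (λ Nb → <⇒≱ (proj₂ (bounds Nb)) (subst (_≤ b) (sym (m*[1+n]≡m*n+m h k)) hk+h≤b))

  in-window : ∀ {c} → c < h → term (h * k + c) ≡ 𝟙 (gcd c h ≟ 1) * 𝟙 (N? (h * k + c))
  in-window {c} _ = begin
    term (h * k + c)
      ≡⟨ cong₂ _*_ (𝟙-yes (h ℕ.≤? h * k + c) (≤-trans (m≤m*n h k) (m≤m+n (h * k) c)))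
                   (cong (λ g → 𝟙 (g ≟ 1) * 𝟙 (N? (h * k + c))) (trans (gcd[m,m*n+o]≡gcd[m,o] h k c) (gcd-comm h c))) ⟩
    1 * (𝟙 (gcd c h ≟ 1) * 𝟙 (N? (h * k + c)))
      ≡⟨ *-identityˡ _ ⟩
    𝟙 (gcd c h ≟ 1) * 𝟙 (N? (h * k + c))
      ∎

-- k is suc k′ with k′ = suc k₂, so that both k and k - 1 are successors, on which frac computes.
module _ (h k₂ n : ℕ) .{{_ : NonZero h}} (hk≤1+n : h * suc (suc k₂) ≤ suc n) where

  private
    k′ k : ℕ
    k′ = suc k₂
    k = suc k′

    h[2k∸1]≡2hk′+h : h * (2 * k ∸ 1) ≡ 2 * (h * k′) + h
    h[2k∸1]≡2hk′+h = begin
      h * (2 * k ∸ 1)      ≡⟨ cong (h *_) (+-suc k′ (k′ + 0)) ⟩  -- 2 * k ∸ 1 computes to k′ + suc (k′ + 0)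
      h * suc (2 * k′)     ≡⟨ *-suc h (2 * k′) ⟩
      h + h * (2 * k′)     ≡⟨ +-comm h (h * (2 * k′)) ⟩
      h * (2 * k′) + h     ≡⟨ cong (_+ h) (x*[y*z]≡y*[x*z] h 2 k′) ⟩
      2 * (h * k′) + h     ∎

    N₁ : ℕ → Set
    N₁ b = b < h * k × h * k′ ≤ b

    N₁? : ∀ b → Dec (N₁ b)
    N₁? b = (b ℕ.<? h * k) ×-dec (h * k′ ℕ.≤? b)

    Q₁ : ℚ → Set
    Q₁ α = frac (ℤ.+ 1) k ℚ.< α × α ℚ.≤ frac (ℤ.+ 1) k′

    Q₁? : ∀ α → Dec (Q₁ α)
    Q₁? α = (frac (ℤ.+ 1) k ℚP.<? α) ×-dec (α ℚP.≤? frac (ℤ.+ 1) k′)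

    Q₁⇔N₁ : ∀ d → Q₁ (frac (ℤ.+ h) (suc d)) ⇔ N₁ (suc d)
    Q₁⇔N₁ d = subst (λ b → Q₁ (frac (ℤ.+ h) (suc d)) ⇔ (b < h * k × h * k′ ≤ b)) (*-identityˡ (suc d))
                    (frac<frac⇔ 1 k′ h d ×-⇔ frac≤frac⇔ h d 1 k₂)

    N₁-in-window : ∀ {c} → c < h → N₁ (h * k′ + c)
    N₁-in-window {c} c<h =
      subst (h * k′ + c <_) (sym (m*[1+n]≡m*n+m h k′)) (+-monoʳ-< (h * k′) c<h) , m≤m+n (h * k′) c

    N₂ : ℕ → Set
    N₂ b = b < h * k × h * (2 * k ∸ 1) < 2 * b

    N₂? : ∀ b → Dec (N₂ b)
    N₂? b = (b ℕ.<? h * k) ×-dec (h * (2 * k ∸ 1) ℕ.<? 2 * b)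

    Q₂ : ℚ → Set
    Q₂ α = frac (ℤ.+ 1) k ℚ.< α × α ℚ.< frac (ℤ.+ 2) (2 * k ∸ 1)

    Q₂? : ∀ α → Dec (Q₂ α)
    Q₂? α = (frac (ℤ.+ 1) k ℚP.<? α) ×-dec (α ℚP.<? frac (ℤ.+ 2) (2 * k ∸ 1))

    Q₂⇔N₂ : ∀ d → Q₂ (frac (ℤ.+ h) (suc d)) ⇔ N₂ (suc d)
    Q₂⇔N₂ d = subst (λ b → Q₂ (frac (ℤ.+ h) (suc d)) ⇔ (b < h * k × h * (2 * k ∸ 1) < 2 * suc d))
                    (*-identityˡ (suc d))
                    (frac<frac⇔ 1 k′ h d ×-⇔ frac<frac⇔ h d 2 (2 * k ∸ 2))

    N₂-bounds : ∀ {b} → N₂ b → h * k′ ≤ b × b < h * k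
    N₂-bounds {b} (b<hk , lt) = <⇒≤ (*-cancelˡ-< 2 (h * k′) b 2hk′<2b) , b<hk
      where
      2hk′<2b : 2 * (h * k′) < 2 * b
      2hk′<2b = ≤-<-trans (m≤m+n (2 * (h * k′)) h) (subst (_< 2 * b) h[2k∸1]≡2hk′+h lt)

    N₂-in-window : ∀ {c} → c < h → N₂ (h * k′ + c) ⇔ h < 2 * c
    N₂-in-window {c} c<h = mk⇔
      (λ (_ , lt) → +-cancelˡ-< (2 * (h * k′)) h (2 * c) (subst₂ _<_ h[2k∸1]≡2hk′+h 2[hk′+c]≡2hk′+2c lt))
      (λ h<2c → proj₁ (N₁-in-window c<h)
              , subst₂ _<_ (sym h[2k∸1]≡2hk′+h) (sym 2[hk′+c]≡2hk′+2c) (+-monoʳ-< (2 * (h * k′)) h<2c))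
      where
      2[hk′+c]≡2hk′+2c : 2 * (h * k′ + c) ≡ 2 * (h * k′) + 2 * c
      2[hk′+c]≡2hk′+2c = *-distribˡ-+ 2 (h * k′) c

  count-1/k<α≤1/[k-1] : length (filter (withNumerator? Q₁? h) (farey n)) ≡ φ h
  count-1/k<α≤1/[k-1] = begin
    length (filter (withNumerator? Q₁? h) (farey n))
      ≡⟨ count-withNumerator Q₁? h N₁? Q₁⇔N₁ n ⟩
    ∑[ b < suc n ] (𝟙 (h ℕ.≤? b) * (𝟙 (gcd h b ≟ 1) * 𝟙 (N₁? b)))
      ≡⟨ ∑-coprime-window N₁? h k′ n hk≤1+n (λ (lt , le) → le , lt) ⟩
    ∑[ c < h ] (𝟙 (gcd c h ≟ 1) * 𝟙 (N₁? (h * k′ + c)))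
      ≡⟨ ∑-cong h (λ {c} c<h → trans (cong (𝟙 (gcd c h ≟ 1) *_) (𝟙-yes (N₁? (h * k′ + c)) (N₁-in-window c<h)))
                                     (*-identityʳ (𝟙 (gcd c h ≟ 1)))) ⟩
    ∑[ c < h ] 𝟙 (gcd c h ≟ 1)
      ≡⟨ φ≡∑coprime h ⟨
    φ h
      ∎

  count-1/k<α<2/[2k-1] : 2 < h → length (filter (withNumerator? Q₂? h) (farey n)) ≡ φ h / 2
  count-1/k<α<2/[2k-1] 2<h = begin
    length (filter (withNumerator? Q₂? h) (farey n))
      ≡⟨ count-withNumerator Q₂? h N₂? Q₂⇔N₂ n ⟩
    ∑[ b < suc n ] (𝟙 (h ℕ.≤? b) * (𝟙 (gcd h b ≟ 1) * 𝟙 (N₂? b)))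
      ≡⟨ ∑-coprime-window N₂? h k′ n hk≤1+n N₂-bounds ⟩
    ∑[ c < h ] (𝟙 (gcd c h ≟ 1) * 𝟙 (N₂? (h * k′ + c)))
      ≡⟨ ∑-cong h (λ {c} c<h → cong (𝟙 (gcd c h ≟ 1) *_)
                                 (𝟙-⇔ (N₂-in-window c<h) (N₂? (h * k′ + c)) (h ℕ.<? 2 * c))) ⟩
    ∑[ c < h ] (𝟙 (gcd c h ≟ 1) * 𝟙 (h ℕ.<? 2 * c))
      ≡⟨ φ/2≡∑coprime>h/2 h 2<h ⟨
    φ h / 2
      ∎

open import Data.Integer using (+_)
open import Data.Rational.Properties using (_<?_; _≤?_)

lemma1 : (k n h : ℕ) → k > 1 → n > 0 → h > 0 → n ≥ k * h ∸ 1 →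
    (length (filter (λ α → (ℤP._≟_ (ℚ.↥ α) (+ h))
                     ×-dec ((frac (+ 1) k <? α) ×-dec (α ≤? frac (+ 1) (k ∸ 1))))
                    (farey n)) ≡ φ h)
    × (h > 2 →
       length (filter (λ α → (ℤP._≟_ (ℚ.↥ α) (+ h))
                        ×-dec ((frac (+ 1) k <? α) ×-dec (α <? frac (+ 2) (2 * k ∸ 1))))
                       (farey n)) ≡ φ h / 2)
lemma1 zero           n h         ()       _ _  _
lemma1 (suc zero)     n h         (s≤s ()) _ _  _
lemma1 (suc (suc _))  n zero      _        _ () _
lemma1 k@(suc (suc k₂)) n h@(suc _) _      _ _  kh∸1≤n =
  count-1/k<α≤1/[k-1] h k₂ n hk≤1+n , count-1/k<α<2/[2k-1] h k₂ n hk≤1+n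
  where
  -- suc (k * h ∸ 1) computes to k * h, as k and h are successors
  hk≤1+n : h * k ≤ suc n
  hk≤1+n = subst (_≤ suc n) (*-comm k h) (s≤s kh∸1≤n)
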